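{- Fix integers $\theta\ge 0$, $\tau\ge0$. Under the duality bijection between homopolymer secondary structures with at least one link and admissible weighted rooted plane trees (described in the context), a secondary structure $S$ with at least one link is G-saturated if and only if its dual weighted tree $T$ satisfies both: (i) every corner at a leaf of $T$ has weight at most $\theta+1$; (ii) no two adjacent corners of $T$ both have strictly positive weight.
   Context: A homopolymer secondary structure of length $n$ with parameters $\theta,\tau\ge0$ is a set $S$ of pairs (links) $(i,j)$, $1\le i<j\le n$, such that no position lies in two links, there are no $(i,j),(k,\ell)\in S$ with $i<k<j<\ell$, every $(i,j)\in S$ has $j-i>\theta$, and every stem has length at least $\tau$. A link $(i,j)$ is stacked onto $(i',j')$ if $i'=i+1$, $j'=j-1$; a stem is a maximal sequence of links $\ell_0,\dots,\ell_k$ with $\ell_m$ stacked onto $\ell_{m+1}$, and $k$ is its length. A position is free if it is in no link. $S$ is G-saturated if it is not possible to add a link to $S$ so as to extend an existing stem while keeping a valid secondary structure, i.e. there is no $(i,j)\notin S$ such that $S\cup\{(i,j)\}$ is a secondary structure (same $\theta,\tau$) and $(i-1,j+1)\in S$ or $(i+1,j-1)\in S$. Duality: a segment of $S$ is a sequence $i,\dots,j$ with $i<j$, where $i=0$ or $i$ is linked, $j=n+1$ or $j$ is linked, and all of $i+1,\dots,j-1$ are free. Replace each stem by a single link and each segment by a segment with no free element, obtaining $R$. Draw $R$ as arcs above a line; put a vertex in each region (including the outer one) and for each link an edge joining the regions on its two sides. The result is a plane tree $T$ rooted at the outer-region vertex, the root being placed between the segment starting at $0$ and the segment ending at $n+1$.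 Edges of $T$ correspond to stems, corners of $T$ (sectors between consecutive edges around a vertex, the root splitting a sector at the root vertex) correspond to segments. Corner weight = number of free elements in the segment; edge weight = stem length. Leaf: node with no children; inner node: at least one child. The weighted tree is admissible if each non-root node with one child has at least one positive-weight corner, each leaf corner has weight $\ge\theta$, and each edge has weight $\ge\tau$; this gives a bijection between secondary structures with at least one link and admissible weighted rooted plane trees with at least one edge. Two corners are adjacent if they are incident to the same vertex $v$ and lie on the two sides of a common edge incident to $v$; the two corners on either side of the root are considered adjacent only when the root vertex has exactly one child. -}

module Defs where

open import Data.Nat using (ℕ; zero; suc; _+_; _*_; _∸_; _≤_; _<_)
open import Data.Bool using (Bool; true; false)
open import Data.Product using (Σ; _×_; _,_; proj₁; proj₂)
open import Data.Sum using (_⊎_)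
open import Data.Unit using (⊤)
open import Data.List using (List; []; _∷_; _++_; map; length)
open import Data.List.Relation.Unary.All using (All)
open import Data.List.Relation.Unary.Any using (Any)
open import Data.List.Membership.Propositional using (_∈_; _∉_)
open import Relation.Binary.PropositionalEquality using (_≡_; _≢_)
open import Relation.Nullary using (¬_)

Link : Set
Link = ℕ × ℕ

Stacked : Link → Link → Set
Stacked (i , j) (i' , j') = (i' ≡ suc i) × (suc j' ≡ j)

IsStem : List Link → ℕ → ℕ → ℕ → Set
IsStem S i j k =
  (∀ m → m ≤ k → (i + m , j ∸ m) ∈ S)
  × (∀ a b → (a , b) ∈ S → ¬ Stacked (a , b) (i , j))
  × (∀ a b → (a , b) ∈ S → ¬ Stacked (i + k , j ∸ k) (a , b))

record SecStruct (θ τ n : ℕ) (S : List Link) : Set where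
  field
    inRange   : ∀ i j → (i , j) ∈ S → (1 ≤ i) × (i < j) × (j ≤ n)
    minLoop   : ∀ i j → (i , j) ∈ S → θ < j ∸ i
    disjoint  : ∀ i j k l → (i , j) ∈ S → (k , l) ∈ S → (i , j) ≢ (k , l) →
                (i ≢ k) × (i ≢ l) × (j ≢ k) × (j ≢ l)
    noCross   : ∀ i j k l → (i , j) ∈ S → (k , l) ∈ S →
                ¬ ((i < k) × (k < j) × (j < l))
    stemLen   : ∀ i j k → IsStem S i j k → τ ≤ k

GSaturated : (θ τ n : ℕ) → List Link → Set
GSaturated θ τ n S =
  ∀ i j → (i , j) ∉ S → SecStruct θ τ n ((i , j) ∷ S) →
  ¬ ((Σ ℕ λ a → Σ ℕ λ b → ((a , b) ∈ S) × Stacked (a , b) (i , j))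
     ⊎ (Σ ℕ λ a → Σ ℕ λ b → ((a , b) ∈ S) × Stacked (i , j) (a , b)))

-- A node with k children carries k+1 corners c₀, c₁, ..., c_k in planar
-- order: c₀, (edge e₁ to child 1), c₁, (edge e₂), c₂, ..., (edge e_k), c_k.
-- For a non-root node, c₀ and c_k are the corners on the two sides of the
-- edge to its parent (for a leaf c₀ = c_k is its only corner); for the root,
-- c₀ and c_k are the corners on either side of the root.
-- `node c₀ ((w₁ , t₁ , c₁) ∷ ... ∷ (w_k , t_k , c_k) ∷ [])` : edge e_m has
-- weight w_m and leads to subtree t_m.

data WTree : Set where
  node : ℕ → List (ℕ × WTree × ℕ) → WTree

Branch : Set
Branch = ℕ × WTree × ℕ

-- P holds at every node; the Bool records whether the node is the root
mutual
  AllNodes : (Bool → ℕ → List Branch → Set) → Bool → WTree → Set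
  AllNodes P r (node c cs) = P r c cs × AllNodesCh P cs

  AllNodesCh : (Bool → ℕ → List Branch → Set) → List Branch → Set
  AllNodesCh P [] = ⊤
  AllNodesCh P ((w , t , c) ∷ cs) = AllNodes P false t × AllNodesCh P cs

corners : ℕ → List Branch → List ℕ
corners c cs = c ∷ map (λ b → proj₂ (proj₂ b)) cs

lastCorner : ℕ → List Branch → ℕ
lastCorner a [] = a
lastCorner a ((_ , _ , b) ∷ cs) = lastCorner b cs

-- pairs (c_{m-1}, c_m) lying on the two sides of the edge to child m
consecutive : ℕ → List Branch → List (ℕ × ℕ)
consecutive a [] = []
consecutive a ((_ , _ , b) ∷ cs) = (a , b) ∷ consecutive b cs

-- the pair (c_k , c₀): across the parent edge for a non-root node with at
-- least one child (for a leaf this would be the same corner twice); across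
-- the root only when the root has exactly one child
wrapPair : Bool → ℕ → List Branch → List (ℕ × ℕ)
wrapPair true c (x ∷ []) = (lastCorner c (x ∷ []) , c) ∷ []
wrapPair true c _ = []
wrapPair false c [] = []
wrapPair false c (x ∷ xs) = (lastCorner c (x ∷ xs) , c) ∷ []

adjacentPairs : Bool → ℕ → List Branch → List (ℕ × ℕ)
adjacentPairs r c cs = consecutive c cs ++ wrapPair r c cs

HasEdge : WTree → Set
HasEdge (node c cs) = 1 ≤ length cs

Admissible : (θ τ : ℕ) → WTree → Set
Admissible θ τ T = AllNodes P true T
  where
  P : Bool → ℕ → List Branch → Set
  P r c cs =
    (r ≡ false → length cs ≡ 1 → Any (λ x → 0 < x) (corners c cs))
    × (cs ≡ [] → θ ≤ c)
    × All (λ b → τ ≤ proj₁ b) cs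

CondLeaf : ℕ → WTree → Set
CondLeaf θ T = AllNodes (λ r c cs → cs ≡ [] → All (λ x → x ≤ suc θ) (corners c cs)) true T

CondAdj : WTree → Set
CondAdj T = AllNodes (λ r c cs → All (λ p → ¬ ((0 < proj₁ p) × (0 < proj₂ p))) (adjacentPairs r c cs)) true T

-- The secondary structure encoded by a weighted tree (inverse of the
-- duality map).  The content of a node with corners c₀..c_k is:
-- c₀ free positions, then for each child m: the w_m+1 left ends of the
-- stem e_m, the content of child m, the w_m+1 right ends, then c_m free
-- positions.  Offsets o = number of positions preceding the content.

mutual
  size : WTree → ℕ
  size (node c cs) = c + sizeCh cs

  sizeCh : List Branch → ℕ
  sizeCh [] = 0
  sizeCh ((w , t , c) ∷ cs) = 2 * suc w + size t + c + sizeCh cs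

upTo' : ℕ → List ℕ
upTo' zero = []
upTo' (suc k) = upTo' k ++ (k ∷ [])

-- links of a stem of weight (length) w, i.e. w+1 links, enclosing s positions,
-- starting after offset o
stemLinks : ℕ → ℕ → ℕ → List Link
stemLinks o w s = map (λ m → (o + suc m , o + 2 * suc w + s ∸ m)) (upTo' (suc w))

mutual
  links : ℕ → WTree → List Link
  links o (node c cs) = linksCh (o + c) cs

  linksCh : ℕ → List Branch → List Link
  linksCh o [] = []
  linksCh o ((w , t , c) ∷ cs) =
    stemLinks o w (size t) ++ links (o + suc w) t
      ++ linksCh (o + 2 * suc w + size t + c) cs

IsDual : (θ τ n : ℕ) → List Link → WTree → Set
IsDual θ τ n S T =
  Admissible θ τ T × (size T ≡ n) × (∀ p → (p ∈ S → p ∈ links 0 T) × (p ∈ links 0 T → p ∈ S))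

-- A link (i , j) extending a stem must be stacked either just inside the innermost link of the
-- stem or just outside its outermost link, with i and j free.  Reading positions off the dual
-- tree, the first is possible exactly when the stem leads to a leaf whose corner has weight at
-- least θ + 2 (the new hairpin must still exceed θ), or to an inner node whose two corners next
-- to the parent edge are both non-empty; the second exactly when both corners flanking the
-- stem's edge are non-empty.  Conversely every such candidate link gives a valid secondary
-- structure: it crosses nothing, because it is stacked on an existing link, and it only
-- lengthens an existing stem, so the bound τ on stem lengths survives.

module Submission where

open import Defs
open import Data.Nat using (ℕ; _≤_)
open import Data.Product using (_×_)
open import Data.List using (List; length)
open import Function.Bundles using (_⇔_)

open import Data.Nat using (zero; suc; _+_; _*_; _∸_; _<_; z≤n; s≤s; _≤?_; _≟_; pred)
open import Data.Nat.Properties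
open import Data.Nat.Tactic.RingSolver using (solve-∀)
open import Data.Product using (Σ; _,_; proj₁; proj₂)
open import Data.Sum using (_⊎_; inj₁; inj₂; [_,_]′)
open import Data.Bool using (Bool; true; false)
open import Data.Unit using (tt)
open import Data.Empty using (⊥; ⊥-elim)
open import Data.List using ([]; _∷_; _++_; map)
open import Data.List.Relation.Unary.All using (All; []; _∷_)
open import Data.List.Relation.Unary.All.Properties using (++⁺; ++⁻ˡ; ++⁻ʳ)
open import Data.List.Relation.Unary.Any using (here; there)
open import Data.List.Membership.Propositional using (_∈_; _∉_)
open import Data.List.Relation.Binary.Subset.Propositional using (_⊆_)
open import Data.List.Membership.Propositional.Properties using (∈-++⁺ˡ; ∈-++⁺ʳ; ∈-++⁻; ∈-map⁺; ∈-map⁻)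
open import Relation.Binary.PropositionalEquality
open import Relation.Nullary using (¬_; yes; no)
open import Data.Product.Properties using (,-injectiveˡ; ,-injectiveʳ)
open import Function.Base using (_∘_)
open import Function.Bundles using (mk⇔)

Free : List Link → ℕ → Set
Free S x = ∀ k l → (k , l) ∈ S → (x ≢ k) × (x ≢ l)

ExtendsStem : List Link → ℕ → ℕ → Set
ExtendsStem S i j = (Σ ℕ λ a → Σ ℕ λ b → ((a , b) ∈ S) × Stacked (a , b) (i , j))
                  ⊎ (Σ ℕ λ a → Σ ℕ λ b → ((a , b) ∈ S) × Stacked (i , j) (a , b))

suc[n∸1]≡n : ∀ {m n} → m < n → suc (n ∸ 1) ≡ n
suc[n∸1]≡n {n = suc n} _ = refl

module AddLink {θ τ n : ℕ} {S : List Link} (SS : SecStruct θ τ n S) where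
  open SecStruct SS

  ¬cross-inner : ∀ i j k l → ExtendsStem S i j → (k , l) ∈ S → ¬ ((i < k) × (k < j) × (j < l))
  ¬cross-inner i j k l (inj₁ (a , b , ab , refl , refl)) kl (ik , kj , jl) =
    noCross a b k l ab kl (<-trans (n<1+n a) ik , <-trans kj (n<1+n j) , b<l)
    where
    b<l : suc j < l
    b<l = ≤∧≢⇒< jl (proj₂ (proj₂ (proj₂ (disjoint a (suc j) k l ab kl
             (<⇒≢ (<-trans (n<1+n a) ik) ∘ ,-injectiveˡ)))))
  ¬cross-inner i j k l (inj₂ (a , b , ab , refl , refl)) kl (ik , kj , jl) =
    noCross (suc i) b k l ab kl (a<k , k<b , <-trans (n<1+n b) jl)
    where
    different : (suc i , b) ≢ (k , l)
    different = <⇒≢ (<-trans (n<1+n b) jl) ∘ ,-injectiveʳ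
    a<k : suc i < k
    a<k = ≤∧≢⇒< ik (proj₁ (disjoint (suc i) b k l ab kl different))
    k<b : k < b
    k<b = ≤∧≢⇒< (≤-pred kj) (λ e → proj₁ (proj₂ (proj₂ (disjoint (suc i) b k l ab kl different))) (sym e))

  ¬cross-outer : ∀ i j k l → ExtendsStem S i j → (k , l) ∈ S → ¬ ((k < i) × (i < l) × (l < j))
  ¬cross-outer i j k l (inj₁ (a , b , ab , refl , refl)) kl (ki , il , lj) =
    noCross k l a (suc j) kl ab (k<a , <-trans (n<1+n a) il , <-trans lj (n<1+n j))
    where
    k<a : k < a
    k<a = ≤∧≢⇒< (≤-pred ki) (λ e → proj₁ (disjoint a (suc j) k l ab kl
             (>⇒≢ (<-trans lj (n<1+n j)) ∘ ,-injectiveʳ)) (sym e))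
  ¬cross-outer i j k l (inj₂ (a , b , ab , refl , refl)) kl (ki , il , lj) =
    noCross k l (suc i) b kl ab (<-trans ki (n<1+n i) , a<l , l<b)
    where
    different : (suc i , b) ≢ (k , l)
    different = >⇒≢ (<-trans ki (n<1+n i)) ∘ ,-injectiveˡ
    a<l : suc i < l
    a<l = ≤∧≢⇒< il (proj₁ (proj₂ (disjoint (suc i) b k l ab kl different)))
    l<b : l < b
    l<b = ≤∧≢⇒< (≤-pred lj) (λ e → proj₂ (proj₂ (proj₂ (disjoint (suc i) b k l ab kl different))) (sym e))

  module _ (i j : ℕ) (fi : Free S i) (fj : Free S j) where
    S' : List Link
    S' = (i , j) ∷ S

    ∉S : (i , j) ∉ S
    ∉S m = proj₁ (fi i j m) refl

    isStem-avoiding : ∀ i0 j0 k → (∀ m → m ≤ k → (i0 + m , j0 ∸ m) ≢ (i , j)) →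
      IsStem S' i0 j0 k → IsStem S i0 j0 k
    isStem-avoiding i0 j0 k avoid (ls , top , bottom) =
      (λ m le → drop m le (ls m le)) , (λ a b m → top a b (there m)) , (λ a b m → bottom a b (there m))
      where
      drop : ∀ m → m ≤ k → (i0 + m , j0 ∸ m) ∈ S' → (i0 + m , j0 ∸ m) ∈ S
      drop m le (here e) = ⊥-elim (avoid m le e)
      drop m le (there x) = x

    -- Cutting the stem just before the new link leaves a stem of S.
    stem-below-new : ∀ i0 j0 k m → suc m ≤ k → i0 + suc m ≡ i → j0 ∸ suc m ≡ j →
      IsStem S' i0 j0 k → τ ≤ k
    stem-below-new i0 j0 k m le ei ej (ls , top , _) =
      ≤-trans (stemLen i0 j0 m (ls' , (λ a b x → top a b (there x)) , maximal)) (≤-trans (n≤1+n m) le)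
      where
      ls' : ∀ m' → m' ≤ m → (i0 + m' , j0 ∸ m') ∈ S
      ls' m' le' with ls m' (≤-trans le' (≤-trans (n≤1+n m) le))
      ... | here e = ⊥-elim (<⇒≢ (s≤s le') (+-cancelˡ-≡ i0 _ _ (trans (cong proj₁ e) (sym ei))))
      ... | there x = x
      maximal : ∀ a b → (a , b) ∈ S → ¬ Stacked (i0 + m , j0 ∸ m) (a , b)
      maximal a b x (ea , eb) = ∉S (subst (_∈ S) (cong₂ _,_ ea' eb') x)
        where
        ea' : a ≡ i
        ea' = trans ea (trans (sym (+-suc i0 m)) ei)
        eb' : b ≡ j
        eb' = trans (cong pred eb) (trans (pred[m∸n]≡m∸[1+n] j0 m) ej)

    -- Removing the new link from the top of the stem leaves a stem of S.
    stem-from-new : ExtendsStem S i j → i < j → ∀ k → IsStem S' i j k → τ ≤ k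
    stem-from-new (inj₁ (a , b , ab , st)) _ k (_ , top , _) = ⊥-elim (top a b (there ab) st)
    stem-from-new (inj₂ (a , b , ab , ea , eb)) _ zero (_ , _ , bottom) =
      ⊥-elim (bottom a b (there ab) (trans ea (cong suc (sym (+-identityʳ i))) , eb))
    stem-from-new (inj₂ _) i<j (suc k) (ls , top , bottom) =
      ≤-trans (stemLen (i + 1) (j ∸ 1) k (ls' , top' , bottom')) (n≤1+n k)
      where
      shiftˡ : ∀ m → i + 1 + m ≡ i + suc m
      shiftˡ m = +-assoc i 1 m
      shiftʳ : ∀ m → j ∸ 1 ∸ m ≡ j ∸ suc m
      shiftʳ m = ∸-+-assoc j 1 m
      ls' : ∀ m → m ≤ k → (i + 1 + m , j ∸ 1 ∸ m) ∈ S
      ls' m le with ls (suc m) (s≤s le)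
      ... | here e = ⊥-elim (0≢1+n (sym (+-cancelˡ-≡ i _ _ (trans (cong proj₁ e) (sym (+-identityʳ i))))))
      ... | there x = subst (_∈ S) (sym (cong₂ _,_ (shiftˡ m) (shiftʳ m))) x
      top' : ∀ a' b' → (a' , b') ∈ S → ¬ Stacked (a' , b') (i + 1 , j ∸ 1)
      top' a' b' x (ea' , eb') = ∉S (subst (_∈ S) (cong₂ _,_ a'≡i b'≡j) x)
        where
        a'≡i : a' ≡ i
        a'≡i = suc-injective (trans (sym ea') (+-comm i 1))
        b'≡j : b' ≡ j
        b'≡j = trans (sym eb') (suc[n∸1]≡n i<j)
      bottom' : ∀ a' b' → (a' , b') ∈ S → ¬ Stacked (i + 1 + k , j ∸ 1 ∸ k) (a' , b')
      bottom' a' b' x (ea' , eb') = bottom a' b' (there x) (trans ea' (cong suc (shiftˡ k)) , trans eb' (shiftʳ k))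

    stem-through-new : ExtendsStem S i j → i < j → ∀ i0 j0 k m → m ≤ k → i0 + m ≡ i → j0 ∸ m ≡ j →
      IsStem S' i0 j0 k → τ ≤ k
    stem-through-new E i<j i0 j0 k zero _ ei refl st with trans (sym (+-identityʳ i0)) ei
    ... | refl = stem-from-new E i<j k st
    stem-through-new E i<j i0 j0 k (suc m) le ei ej st = stem-below-new i0 j0 k m le ei ej st

    stemLen-extended : ExtendsStem S i j → i < j → ∀ i0 j0 k → IsStem S' i0 j0 k → τ ≤ k
    stemLen-extended E i<j i0 j0 k st with i0 ≤? i
    ... | no i0≰i = stemLen i0 j0 k (isStem-avoiding i0 j0 k
            (λ m _ e → i0≰i (subst (i0 ≤_) (cong proj₁ e) (m≤m+n i0 m))) st)
    ... | yes i0≤i with (i ∸ i0) ≤? k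
    ...   | no far = stemLen i0 j0 k (isStem-avoiding i0 j0 k
            (λ m le e → far (subst (_≤ k) (sym (trans (cong (_∸ i0) (sym (cong proj₁ e))) (m+n∸m≡n i0 m))) le)) st)
    ...   | yes near with j0 ∸ (i ∸ i0) ≟ j
    ...     | yes e = stem-through-new E i<j i0 j0 k (i ∸ i0) near (m+[n∸m]≡n i0≤i) e st
    ...     | no ne = stemLen i0 j0 k (isStem-avoiding i0 j0 k
            (λ m le e → ne (trans (cong (j0 ∸_) (trans (cong (_∸ i0) (sym (cong proj₁ e))) (m+n∸m≡n i0 m)))
                               (cong proj₂ e))) st)

    addLink : ExtendsStem S i j → 1 ≤ i → i < j → j ≤ n → θ < j ∸ i → SecStruct θ τ n S'
    addLink E 1≤i i<j j≤n θ< = record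
      { inRange = inRange' ; minLoop = minLoop' ; disjoint = disjoint' ; noCross = noCross'
      ; stemLen = stemLen-extended E i<j }
      where
      inRange' : ∀ a b → (a , b) ∈ S' → (1 ≤ a) × (a < b) × (b ≤ n)
      inRange' a b (here refl) = 1≤i , i<j , j≤n
      inRange' a b (there m) = inRange a b m
      minLoop' : ∀ a b → (a , b) ∈ S' → θ < b ∸ a
      minLoop' a b (here refl) = θ<
      minLoop' a b (there m) = minLoop a b m
      disjoint' : ∀ a b k l → (a , b) ∈ S' → (k , l) ∈ S' → (a , b) ≢ (k , l) →
                  (a ≢ k) × (a ≢ l) × (b ≢ k) × (b ≢ l)
      disjoint' a b k l (here refl) (here refl) ne = ⊥-elim (ne refl)
      disjoint' a b k l (here refl) (there m) ne =
        proj₁ (fi k l m) , proj₂ (fi k l m) , proj₁ (fj k l m) , proj₂ (fj k l m)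
      disjoint' a b k l (there m) (here refl) ne =
        (λ e → proj₁ (fi a b m) (sym e)) , (λ e → proj₁ (fj a b m) (sym e)) ,
        (λ e → proj₂ (fi a b m) (sym e)) , (λ e → proj₂ (fj a b m) (sym e))
      disjoint' a b k l (there m) (there m') ne = disjoint a b k l m m' ne
      noCross' : ∀ a b k l → (a , b) ∈ S' → (k , l) ∈ S' → ¬ ((a < k) × (k < b) × (b < l))
      noCross' a b k l (here refl) (here refl) (a<k , _) = <-irrefl refl a<k
      noCross' a b k l (here refl) (there m) = ¬cross-inner i j k l E m
      noCross' a b k l (there m) (here refl) = ¬cross-outer i j a b E m
      noCross' a b k l (there m) (there m') = noCross a b k l m m'

∈-upTo'⁺ : ∀ {m k} → m < k → m ∈ upTo' k
∈-upTo'⁺ {m} {suc k} lt with m≤n⇒m<n∨m≡n (≤-pred lt)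
... | inj₁ lt' = ∈-++⁺ˡ (∈-upTo'⁺ lt')
... | inj₂ refl = ∈-++⁺ʳ (upTo' k) (here refl)

∈-upTo'⁻ : ∀ {m k} → m ∈ upTo' k → m < k
∈-upTo'⁻ {m} {suc k} x with ∈-++⁻ (upTo' k) x
... | inj₁ y = m<n⇒m<1+n (∈-upTo'⁻ y)
... | inj₂ (here refl) = n<1+n k

-- The right end of the m-th link of a stem, written without truncated subtraction.
stemLinks-right : ∀ o w s m → m ≤ w → o + 2 * suc w + s ∸ m ≡ suc (o + suc w + s + (w ∸ m))
stemLinks-right o w s m le = begin
    o + 2 * suc w + s ∸ m               ≡⟨ cong (λ v → o + 2 * suc v + s ∸ m) (sym w≡d+m) ⟩
    o + 2 * suc (d + m) + s ∸ m         ≡⟨ cong (_∸ m) (ring o d m s) ⟩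
    suc (o + suc (d + m) + s + d) + m ∸ m ≡⟨ m+n∸n≡m _ m ⟩
    suc (o + suc (d + m) + s + d)       ≡⟨ cong (λ v → suc (o + suc v + s + d)) w≡d+m ⟩
    suc (o + suc w + s + d)             ∎
  where
  open ≡-Reasoning
  d : ℕ
  d = w ∸ m
  w≡d+m : d + m ≡ w
  w≡d+m = m∸n+n≡m le
  ring : ∀ o d m s → o + 2 * suc (d + m) + s ≡ suc (o + suc (d + m) + s + d) + m
  ring = solve-∀

∈-stemLinks⁻ : ∀ {o w s x y} → (x , y) ∈ stemLinks o w s →
  Σ ℕ λ m → (m ≤ w) × (x ≡ o + suc m) × (y ≡ suc (o + suc w + s + (w ∸ m)))
∈-stemLinks⁻ {o} {w} {s} mem with ∈-map⁻ (λ m → (o + suc m , o + 2 * suc w + s ∸ m)) mem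
... | m , m∈ , eq = m , le , cong proj₁ eq , trans (cong proj₂ eq) (stemLinks-right o w s m le)
  where
  le : m ≤ w
  le = ≤-pred (∈-upTo'⁻ m∈)

∈-stemLinks⁺ : ∀ {o w s m} → m ≤ w → (o + suc m , suc (o + suc w + s + (w ∸ m))) ∈ stemLinks o w s
∈-stemLinks⁺ {o} {w} {s} {m} le =
  subst (λ v → (o + suc m , v) ∈ stemLinks o w s) (stemLinks-right o w s m le)
    (∈-map⁺ (λ m → (o + suc m , o + 2 * suc w + s ∸ m)) (∈-upTo'⁺ (s≤s le)))

stemLinks-outermost : ∀ {o w s} → (suc o , o + 2 * suc w + s) ∈ stemLinks o w s
stemLinks-outermost {o} {w} {s} =
  subst (λ v → (v , o + 2 * suc w + s) ∈ stemLinks o w s) (+-comm o 1)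
    (∈-map⁺ (λ m → (o + suc m , o + 2 * suc w + s ∸ m)) (∈-upTo'⁺ {0} {suc w} (s≤s z≤n)))

stemLinks-innermost : ∀ {o w s} → (o + suc w , suc (o + suc w + s)) ∈ stemLinks o w s
stemLinks-innermost {o} {w} {s} =
  subst (λ v → (o + suc w , suc v) ∈ stemLinks o w s)
    (trans (cong (o + suc w + s +_) (n∸n≡0 w)) (+-identityʳ _))
    (∈-stemLinks⁺ {o} {w} {s} {w} ≤-refl)

stem-span : ∀ o w s → suc (o + suc w + s + w) ≡ o + 2 * suc w + s
stem-span = solve-∀

+-sizeCh-∷ : ∀ o w t c cs → o + sizeCh ((w , t , c) ∷ cs) ≡ o + 2 * suc w + size t + c + sizeCh cs
+-sizeCh-∷ o w t c cs = ring o (2 * suc w) (size t) c (sizeCh cs)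
  where
  ring : ∀ o A s c R → o + (A + s + c + R) ≡ o + A + s + c + R
  ring = solve-∀

InWindow : ℕ → ℕ → ℕ → Set
InWindow o s x = (o < x) × (x ≤ o + s)

LinkInWindow : ℕ → ℕ → ℕ → ℕ → Set
LinkInWindow o s x y = (o < x) × (x < y) × (y ≤ o + s)

range-mono : ∀ {o s o' s' x y} → o ≤ o' → o' + s' ≤ o + s → LinkInWindow o' s' x y → LinkInWindow o s x y
range-mono o≤o' end≤ (r1 , r2 , r3) = ≤-<-trans o≤o' r1 , r2 , ≤-trans r3 end≤

∈-linksCh-∷⁻ : ∀ {o w t c cs p} → p ∈ linksCh o ((w , t , c) ∷ cs) →
  (p ∈ stemLinks o w (size t)) ⊎ (p ∈ links (o + suc w) t) ⊎ (p ∈ linksCh (o + 2 * suc w + size t + c) cs)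
∈-linksCh-∷⁻ {o} {w} {t} m with ∈-++⁻ (stemLinks o w (size t)) m
... | inj₁ x = inj₁ x
... | inj₂ y with ∈-++⁻ (links (o + suc w) t) y
...   | inj₁ x = inj₂ (inj₁ x)
...   | inj₂ x = inj₂ (inj₂ x)

∈-linksCh-stem : ∀ {o w t c cs p} → p ∈ stemLinks o w (size t) → p ∈ linksCh o ((w , t , c) ∷ cs)
∈-linksCh-stem m = ∈-++⁺ˡ m

∈-linksCh-child : ∀ {o w t c cs p} → p ∈ links (o + suc w) t → p ∈ linksCh o ((w , t , c) ∷ cs)
∈-linksCh-child {o} {w} {t} m = ∈-++⁺ʳ (stemLinks o w (size t)) (∈-++⁺ˡ m)

∈-linksCh-rest : ∀ {o w t c cs p} → p ∈ linksCh (o + 2 * suc w + size t + c) cs → p ∈ linksCh o ((w , t , c) ∷ cs)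
∈-linksCh-rest {o} {w} {t} m = ∈-++⁺ʳ (stemLinks o w (size t)) (∈-++⁺ʳ (links (o + suc w) t) m)

stemLinks-range : ∀ {o w s x y} → (x , y) ∈ stemLinks o w s →
  (o < x) × (x ≤ o + suc w) × (o + suc w + s < y) × (y ≤ o + 2 * suc w + s)
stemLinks-range {o} {w} {s} mem with ∈-stemLinks⁻ mem
... | m , le , refl , refl =
  m<m+n o (s≤s z≤n) , +-monoʳ-≤ o (s≤s le) , s≤s (m≤m+n _ _) ,
  ≤-trans (s≤s (+-monoʳ-≤ (o + suc w + s) (m∸n≤m w m))) (≤-reflexive (stem-span o w s))

block≤ : ∀ o w t c cs → o + (2 * suc w + size t) ≤ o + sizeCh ((w , t , c) ∷ cs)
block≤ o w t c cs = +-monoʳ-≤ o (≤-trans (m≤m+n _ c) (m≤m+n _ (sizeCh cs)))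

block≤rest : ∀ o w t c → o + (2 * suc w + size t) ≤ o + 2 * suc w + size t + c
block≤rest o w t c = ≤-trans (≤-reflexive (sym (+-assoc o _ _))) (m≤m+n _ c)

child≤rest : ∀ o w t c → o + suc w + size t ≤ o + 2 * suc w + size t + c
child≤rest o w t c = ≤-trans (+-monoˡ-≤ (size t) (+-monoʳ-≤ o (m≤m+n (suc w) _))) (m≤m+n _ c)

mutual
  links-range : ∀ o t x y → (x , y) ∈ links o t → LinkInWindow o (size t) x y
  links-range o (node c cs) x y mem =
    range-mono (m≤m+n o c) (≤-reflexive (+-assoc o c (sizeCh cs))) (linksCh-range (o + c) cs x y mem)

  block-range : ∀ o w t x y → ((x , y) ∈ stemLinks o w (size t)) ⊎ ((x , y) ∈ links (o + suc w) t) →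
    LinkInWindow o (2 * suc w + size t) x y
  block-range o w t x y (inj₁ m) with stemLinks-range m
  ... | r1 , r2 , r3 , r4 =
    r1 , ≤-<-trans r2 (≤-<-trans (m≤m+n _ (size t)) r3) , ≤-trans r4 (≤-reflexive (+-assoc o _ _))
  block-range o w t x y (inj₂ m) =
    range-mono (m≤m+n o (suc w))
      (≤-trans (+-monoˡ-≤ (size t) (+-monoʳ-≤ o (m≤m+n (suc w) (suc w + 0)))) (≤-reflexive (+-assoc o _ _)))
      (links-range (o + suc w) t x y m)

  linksCh-range : ∀ o cs x y → (x , y) ∈ linksCh o cs → LinkInWindow o (sizeCh cs) x y
  linksCh-range o ((w , t , c) ∷ cs) x y mem with ∈-linksCh-∷⁻ {o} {w} {t} {c} {cs} mem
  ... | inj₁ m = range-mono ≤-refl (block≤ o w t c cs) (block-range o w t x y (inj₁ m))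
  ... | inj₂ (inj₁ m) = range-mono ≤-refl (block≤ o w t c cs) (block-range o w t x y (inj₂ m))
  ... | inj₂ (inj₂ m) =
    range-mono (≤-trans (m≤m+n o _) (≤-trans (m≤m+n _ (size t)) (m≤m+n _ c)))
      (≤-reflexive (sym (+-sizeCh-∷ o w t c cs)))
      (linksCh-range (o + 2 * suc w + size t + c) cs x y m)

range-below : ∀ {o s k l x} → LinkInWindow o s k l → x ≤ o → (x ≢ k) × (x ≢ l)
range-below (r1 , r2 , _) le = <⇒≢ (≤-<-trans le r1) , <⇒≢ (<-trans (≤-<-trans le r1) r2)

range-above : ∀ {o s k l x} → LinkInWindow o s k l → o + s < x → (x ≢ k) × (x ≢ l)
range-above (_ , r2 , r3) lt = >⇒≢ (<-trans r2 (≤-<-trans r3 lt)) , >⇒≢ (≤-<-trans r3 lt)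

range-¬beyond : ∀ {o s k l x} → LinkInWindow o s k l → o + s ≤ x → ¬ ((x < k) ⊎ (x < l))
range-¬beyond (_ , r2 , r3) le (inj₁ x<k) = <-irrefl refl (<-≤-trans x<k (≤-trans (<⇒≤ (<-≤-trans r2 r3)) le))
range-¬beyond (_ , _ , r3) le (inj₂ x<l) = <-irrefl refl (<-≤-trans x<l (≤-trans r3 le))

∈-linksCh-rest⁻ : ∀ {o w t c cs k l} → (k , l) ∈ linksCh o ((w , t , c) ∷ cs) →
  (o + 2 * suc w + size t + c < k) ⊎ (o + 2 * suc w + size t + c < l) →
  (k , l) ∈ linksCh (o + 2 * suc w + size t + c) cs
∈-linksCh-rest⁻ {o} {w} {t} {c} {cs} m beyond with ∈-linksCh-∷⁻ {o} {w} {t} {c} {cs} m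
... | inj₁ y = ⊥-elim (range-¬beyond (block-range o w t _ _ (inj₁ y)) (block≤rest o w t c) beyond)
... | inj₂ (inj₁ y) = ⊥-elim (range-¬beyond (block-range o w t _ _ (inj₂ y)) (block≤rest o w t c) beyond)
... | inj₂ (inj₂ y) = y

∈-linksCh-child⁻ : ∀ {o w t c cs k l} → (k , l) ∈ linksCh o ((w , t , c) ∷ cs) →
  InWindow (o + suc w) (size t) k ⊎ InWindow (o + suc w) (size t) l → (k , l) ∈ links (o + suc w) t
∈-linksCh-child⁻ {o} {w} {t} {c} {cs} m inside with ∈-linksCh-∷⁻ {o} {w} {t} {c} {cs} m | inside
... | inj₂ (inj₁ y) | _ = y
... | inj₁ y | inj₁ (x , _) = ⊥-elim (<-irrefl refl (<-≤-trans x (proj₁ (proj₂ (stemLinks-range y)))))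
... | inj₁ y | inj₂ (_ , x) = ⊥-elim (<-irrefl refl (<-≤-trans (proj₁ (proj₂ (proj₂ (stemLinks-range y)))) x))
... | inj₂ (inj₂ y) | inj₁ (_ , x) =
  ⊥-elim (<-irrefl refl (<-≤-trans (proj₁ (linksCh-range _ cs _ _ y)) (≤-trans x (child≤rest o w t c))))
... | inj₂ (inj₂ y) | inj₂ (_ , x) with linksCh-range _ cs _ _ y
...   | r1 , r2 , _ = ⊥-elim (<-irrefl refl (<-≤-trans (<-trans r1 r2) (≤-trans x (child≤rest o w t c))))

linksCh-free-below : ∀ o cs x → x ≤ o → Free (linksCh o cs) x
linksCh-free-below o cs x le k l m = range-below (linksCh-range o cs k l m) le

linksCh-free-corner : ∀ o w t c cs x → o + 2 * suc w + size t < x → x ≤ o + 2 * suc w + size t + c →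
  Free (linksCh o ((w , t , c) ∷ cs)) x
linksCh-free-corner o w t c cs x lo hi k l m with ∈-linksCh-∷⁻ {o} {w} {t} {c} {cs} m
... | inj₁ y = range-above (block-range o w t _ _ (inj₁ y)) (subst (_< x) (+-assoc o _ _) lo)
... | inj₂ (inj₁ y) = range-above (block-range o w t _ _ (inj₂ y)) (subst (_< x) (+-assoc o _ _) lo)
... | inj₂ (inj₂ y) = range-below (linksCh-range _ cs k l y) hi

lastCorner-pos : ∀ c cs → 0 < lastCorner c cs → 0 < c + sizeCh cs
lastCorner-pos c [] p = ≤-trans p (m≤m+n c 0)
lastCorner-pos c ((w , t , c') ∷ cs) p = ≤-trans (s≤s z≤n) (m≤n+m _ c)

block<end : ∀ o w t c cs → 0 < lastCorner c cs → o + (2 * suc w + size t) < o + sizeCh ((w , t , c) ∷ cs)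
block<end o w t c cs p =
  +-monoʳ-< o (subst (2 * suc w + size t <_) (sym (+-assoc (2 * suc w + size t) c (sizeCh cs)))
                     (m<m+n _ (lastCorner-pos c cs p)))

linksCh-free-end : ∀ o pc cs → 0 < lastCorner pc cs → Free (linksCh o cs) (o + sizeCh cs)
linksCh-free-end o pc [] p k l ()
linksCh-free-end o pc ((w , t , c) ∷ cs) p k l m with ∈-linksCh-∷⁻ {o} {w} {t} {c} {cs} m
... | inj₁ y = range-above (block-range o w t _ _ (inj₁ y)) (block<end o w t c cs p)
... | inj₂ (inj₁ y) = range-above (block-range o w t _ _ (inj₂ y)) (block<end o w t c cs p)
... | inj₂ (inj₂ y) = subst (Free _) (sym (+-sizeCh-∷ o w t c cs)) (linksCh-free-end _ c cs p) k l y

LeafBounded : ℕ → Bool → ℕ → List Branch → Set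
LeafBounded θ r c cs = cs ≡ [] → All (λ x → x ≤ suc θ) (corners c cs)

NotBothPositive : ℕ × ℕ → Set
NotBothPositive p = ¬ ((0 < proj₁ p) × (0 < proj₂ p))

AdjacentNotBothPositive : Bool → ℕ → List Branch → Set
AdjacentNotBothPositive r c cs = All NotBothPositive (adjacentPairs r c cs)

module Forward {θ τ n : ℕ} {S : List Link} (SS : SecStruct θ τ n S) (G : GSaturated θ τ n S) where
  open SecStruct SS
  open AddLink SS

  Covers : ℕ → ℕ → List Link → Set
  Covers o s L = ∀ k l → (k , l) ∈ S → (InWindow o s k → (k , l) ∈ L) × (InWindow o s l → (k , l) ∈ L)

  covers-narrow : ∀ {o s o' s' L L'} → Covers o s L → o ≤ o' → o' + s' ≤ o + s →
    (∀ {k l} → (k , l) ∈ L → InWindow o' s' k ⊎ InWindow o' s' l → (k , l) ∈ L') → Covers o' s' L'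
  covers-narrow {o} {s} {o'} {s'} cov o≤o' end≤ restrict k l m =
      (λ w → restrict (proj₁ (cov k l m) (widen w)) (inj₁ w))
    , (λ w → restrict (proj₂ (cov k l m) (widen w)) (inj₂ w))
    where
    widen : ∀ {x} → InWindow o' s' x → InWindow o s x
    widen (a , b) = ≤-<-trans o≤o' a , ≤-trans b end≤

  free-in-window : ∀ {o s L x} → Covers o s L → InWindow o s x → Free L x → Free S x
  free-in-window cov (a , b) free k l m =
      (λ e → proj₁ (free k l (proj₁ (cov k l m) (subst (InWindow _ _) e (a , b)))) e)
    , (λ e → proj₂ (free k l (proj₂ (cov k l m) (subst (InWindow _ _) e (a , b)))) e)

  ¬extendable : ∀ i j → Free S i → Free S j → 1 ≤ i → i < j → j ≤ n → θ < j ∸ i → ¬ ExtendsStem S i j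
  ¬extendable i j fi fj 1≤i i<j j≤n θ< E = G i j (∉S i j fi fj) (addLink i j fi fj E 1≤i i<j j≤n θ<) E

  -- Otherwise (q + 1 , q + c) could be added inside the innermost link (q , q + c + 1).
  leaf-corner-≤ : ∀ q c → (q , suc (q + c)) ∈ S → Covers q c [] → q + c ≤ n → c ≤ suc θ
  leaf-corner-≤ q c inner cov bnd with c ≤? suc θ
  ... | yes c≤ = c≤
  ... | no c≰ = ⊥-elim (¬extendable (suc q) (q + c) (free (n<1+n q) 1+q≤q+c) (free q<q+c ≤-refl)
                          (s≤s z≤n) 1+q<q+c bnd θ<c∸1 (inj₁ (q , suc (q + c) , inner , refl , refl)))
    where
    2+θ≤c : 2 + θ ≤ c
    2+θ≤c = ≰⇒> c≰
    free : ∀ {x} → q < x → x ≤ q + c → Free S x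
    free a b = free-in-window cov (a , b) (λ _ _ ())
    1+q<q+c : suc q < q + c
    1+q<q+c = subst (_≤ q + c) (+-comm q 2) (+-monoʳ-≤ q (≤-trans (s≤s (s≤s z≤n)) 2+θ≤c))
    1+q≤q+c : suc q ≤ q + c
    1+q≤q+c = <⇒≤ 1+q<q+c
    q<q+c : q < q + c
    q<q+c = m<m+n q (≤-trans (s≤s z≤n) 2+θ≤c)
    θ<c∸1 : θ < q + c ∸ suc q
    θ<c∸1 = subst (θ <_) (sym (trans (cong (q + c ∸_) (+-comm 1 q)) ([m+n]∸[m+o]≡n∸o q c 1)))
              (∸-monoˡ-≤ 1 2+θ≤c)

  -- Otherwise (q + 1 , q + size) could be added inside the link (q , q + size + 1) above the node.
  wrap-not-both-positive : ∀ q c w t d cs → let R = sizeCh ((w , t , d) ∷ cs) in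
    links q (node c ((w , t , d) ∷ cs)) ⊆ S → (q , suc (q + (c + R))) ∈ S →
    Covers q (c + R) (links q (node c ((w , t , d) ∷ cs))) → q + (c + R) ≤ n →
    NotBothPositive (lastCorner c ((w , t , d) ∷ cs) , c)
  wrap-not-both-positive q c w t d cs sub inner cov bnd (lp , cp) =
    ¬extendable (suc q) (q + (c + R)) fi fj (s≤s z≤n) i<j bnd θ< (inj₁ (q , suc (q + (c + R)) , inner , refl , refl))
    where
    R : ℕ
    R = sizeCh ((w , t , d) ∷ cs)
    fi : Free S (suc q)
    fi = free-in-window cov (n<1+n q , ≤-trans (m<m+n q cp) (+-monoʳ-≤ q (m≤m+n c R)))
           (linksCh-free-below (q + c) ((w , t , d) ∷ cs) (suc q) (subst (_≤ q + c) (+-comm q 1) (+-monoʳ-≤ q cp)))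
    fj : Free S (q + (c + R))
    fj = free-in-window cov (m<m+n q (≤-trans cp (m≤m+n c R)) , ≤-refl)
           (subst (Free _) (+-assoc q c R) (linksCh-free-end (q + c) c ((w , t , d) ∷ cs) lp))
    outer∈ : (suc (q + c) , q + c + 2 * suc w + size t) ∈ links q (node c ((w , t , d) ∷ cs))
    outer∈ = ∈-linksCh-stem {q + c} {w} {t} {d} {cs} stemLinks-outermost
    range : LinkInWindow q (c + R) (suc (q + c)) (q + c + 2 * suc w + size t)
    range = links-range q (node c ((w , t , d) ∷ cs)) _ _ outer∈
    i<j : suc q < q + (c + R)
    i<j = <-≤-trans (≤-<-trans (proj₁ range) (proj₁ (proj₂ range))) (proj₂ (proj₂ range))
    θ< : θ < q + (c + R) ∸ suc q
    θ< = <-≤-trans (minLoop _ _ (sub outer∈)) (∸-mono (proj₂ (proj₂ range)) (proj₁ range))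

  -- Otherwise (o , E + 1) could be added around the outermost link (o + 1 , E) of the stem.
  edge-not-both-positive : ∀ o pc w t c cs → linksCh o ((w , t , c) ∷ cs) ⊆ S →
    Covers o (sizeCh ((w , t , c) ∷ cs)) (linksCh o ((w , t , c) ∷ cs)) → o + sizeCh ((w , t , c) ∷ cs) ≤ n →
    pc ≤ o → (0 < pc → Free S o) → NotBothPositive (pc , c)
  edge-not-both-positive o pc w t c cs sub cov bnd pc≤o free-o (pp , cp) =
    ¬extendable o (suc E) (free-o pp) fj (≤-trans pp pc≤o) (s≤s o≤E) (≤-trans 1+E≤end bnd) θ<
      (inj₂ (suc o , E , sub (∈-linksCh-stem {o} {w} {t} {c} {cs} stemLinks-outermost) , refl , refl))
    where
    E : ℕ
    E = o + 2 * suc w + size t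
    o≤E : o ≤ E
    o≤E = ≤-trans (m≤m+n o _) (m≤m+n _ (size t))
    1+E≤E+c : suc E ≤ E + c
    1+E≤E+c = subst (_≤ E + c) (+-comm E 1) (+-monoʳ-≤ E cp)
    1+E≤end : suc E ≤ o + sizeCh ((w , t , c) ∷ cs)
    1+E≤end = ≤-trans 1+E≤E+c (≤-trans (m≤m+n _ (sizeCh cs)) (≤-reflexive (sym (+-sizeCh-∷ o w t c cs))))
    fj : Free S (suc E)
    fj = free-in-window cov (s≤s o≤E , 1+E≤end) (linksCh-free-corner o w t c cs (suc E) ≤-refl 1+E≤E+c)
    θ< : θ < suc E ∸ o
    θ< = <-≤-trans (minLoop _ _ (sub (∈-linksCh-stem {o} {w} {t} {c} {cs} stemLinks-outermost)))
                   (∸-mono (n≤1+n E) (n≤1+n o))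

  mutual
    saturated-node : ∀ q t → links q t ⊆ S → (q , suc (q + size t)) ∈ S → Covers q (size t) (links q t) →
      q + size t ≤ n → AllNodes (LeafBounded θ) false t × AllNodes AdjacentNotBothPositive false t
    saturated-node q (node c []) sub inner cov bnd =
      ((λ _ → leaf-corner-≤ q c (subst (λ v → (q , suc (q + v)) ∈ S) c+0≡c inner)
                 (subst (λ v → Covers q v []) c+0≡c cov) (subst (λ v → q + v ≤ n) c+0≡c bnd) ∷ []) , tt)
      , ([] , tt)
      where
      c+0≡c : c + 0 ≡ c
      c+0≡c = +-identityʳ c
    saturated-node q (node c ((w , t , d) ∷ cs)) sub inner cov bnd
      with saturated-children (q + c) c ((w , t , d) ∷ cs) sub
             (covers-narrow cov (m≤m+n q c) (≤-reflexive (+-assoc q c _)) (λ m _ → m))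
             (≤-trans (≤-reflexive (+-assoc q c _)) bnd) (m≤n+m c q)
             (λ cp → free-in-window cov (m<m+n q cp , +-monoʳ-≤ q (m≤m+n c _))
                       (linksCh-free-below (q + c) ((w , t , d) ∷ cs) (q + c) ≤-refl))
    ... | edges , leaves , adjacent =
      ((λ ()) , leaves) , (++⁺ edges (wrap-not-both-positive q c w t d cs sub inner cov bnd ∷ []) , adjacent)

    saturated-children : ∀ o pc cs → linksCh o cs ⊆ S → Covers o (sizeCh cs) (linksCh o cs) →
      o + sizeCh cs ≤ n → pc ≤ o → (0 < pc → Free S o) →
      All NotBothPositive (consecutive pc cs) × AllNodesCh (LeafBounded θ) cs × AllNodesCh AdjacentNotBothPositive cs
    saturated-children o pc [] sub cov bnd pc≤o free-o = [] , tt , tt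
    saturated-children o pc ((w , t , c) ∷ cs) sub cov bnd pc≤o free-o =
      combine
        (saturated-node (o + suc w) t (λ m → sub (∈-linksCh-child {o} {w} {t} {c} {cs} m))
           (sub (∈-linksCh-stem {o} {w} {t} {c} {cs} stemLinks-innermost))
           (covers-narrow cov (m≤m+n o (suc w)) child≤end (∈-linksCh-child⁻ {o} {w} {t} {c} {cs}))
           (≤-trans child≤end bnd))
        (saturated-children o' c cs (λ m → sub (∈-linksCh-rest {o} {w} {t} {c} {cs} m))
           (covers-narrow cov o≤o' (≤-reflexive (sym (+-sizeCh-∷ o w t c cs)))
             (λ m inside → ∈-linksCh-rest⁻ {o} {w} {t} {c} {cs} m (beyond inside)))
           (subst (_≤ n) (+-sizeCh-∷ o w t c cs) bnd) (m≤n+m c E)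
           (λ cp → free-in-window cov (≤-<-trans o≤E (m<m+n E cp) , o'≤end)
                     (linksCh-free-corner o w t c cs o' (m<m+n E cp) ≤-refl)))
      where
      E o' : ℕ
      E = o + 2 * suc w + size t
      o' = E + c
      o≤E : o ≤ E
      o≤E = ≤-trans (m≤m+n o _) (m≤m+n _ (size t))
      o≤o' : o ≤ o'
      o≤o' = ≤-trans o≤E (m≤m+n E c)
      o'≤end : o' ≤ o + sizeCh ((w , t , c) ∷ cs)
      o'≤end = ≤-trans (m≤m+n o' _) (≤-reflexive (sym (+-sizeCh-∷ o w t c cs)))
      child≤end : o + suc w + size t ≤ o + sizeCh ((w , t , c) ∷ cs)
      child≤end = ≤-trans (child≤rest o w t c) o'≤end
      beyond : ∀ {x y} → InWindow o' (sizeCh cs) x ⊎ InWindow o' (sizeCh cs) y → (o' < x) ⊎ (o' < y)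
      beyond (inj₁ (a , _)) = inj₁ a
      beyond (inj₂ (a , _)) = inj₂ a
      combine : AllNodes (LeafBounded θ) false t × AllNodes AdjacentNotBothPositive false t →
        All NotBothPositive (consecutive c cs) × AllNodesCh (LeafBounded θ) cs × AllNodesCh AdjacentNotBothPositive cs →
        All NotBothPositive (consecutive pc ((w , t , c) ∷ cs)) ×
        AllNodesCh (LeafBounded θ) ((w , t , c) ∷ cs) × AllNodesCh AdjacentNotBothPositive ((w , t , c) ∷ cs)
      combine (leaves-t , adjacent-t) (edges , leaves , adjacent) =
        (edge-not-both-positive o pc w t c cs sub cov bnd pc≤o free-o ∷ edges) ,
        (leaves-t , leaves) , (adjacent-t , adjacent)

module Backward {θ n : ℕ} {S : List Link} (i j : ℕ) (fi : Free S i) (fj : Free S j) (1≤i : 1 ≤ i)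
                (j≤n : j ≤ n) (θ< : θ < j ∸ i) where

  Endpoint : ℕ → Set
  Endpoint x = Σ ℕ λ k → Σ ℕ λ l → ((k , l) ∈ S) × ((x ≡ k) ⊎ (x ≡ l))

  ¬endpoint : ∀ {x} → Free S x → ¬ Endpoint x
  ¬endpoint free (k , l , m , inj₁ e) = proj₁ (free k l m) e
  ¬endpoint free (k , l , m , inj₂ e) = proj₂ (free k l m) e

  endpointˡ : ∀ {k l} → (k , l) ∈ S → Endpoint k
  endpointˡ {k} {l} m = k , l , m , inj₁ refl

  endpointʳ : ∀ {k l} → (k , l) ∈ S → Endpoint l
  endpointʳ {k} {l} m = k , l , m , inj₂ refl

  -- For children starting after offset o, preceded by the corner pc: an empty corner on either side
  -- means the adjacent position is taken by a link or lies outside 1..n.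
  BlockedBefore : ℕ → ℕ → Set
  BlockedBefore o pc = pc ≡ 0 → Endpoint o ⊎ o ≡ 0

  BlockedAfter : ℕ → ℕ → List Branch → Set
  BlockedAfter o pc cs = lastCorner pc cs ≡ 0 → Endpoint (suc (o + sizeCh cs)) ⊎ n < suc (o + sizeCh cs)

  lastCorner≡0⇒endpoint : ∀ o pc x xs → lastCorner pc (x ∷ xs) ≡ 0 →
    Σ ℕ λ k → (k , o + sizeCh (x ∷ xs)) ∈ linksCh o (x ∷ xs)
  lastCorner≡0⇒endpoint o pc (w , t , c) [] e =
    suc o , subst (λ v → (suc o , v) ∈ linksCh o ((w , t , c) ∷ [])) (sym end≡E)
              (∈-linksCh-stem {o} {w} {t} {c} {[]} stemLinks-outermost)
    where
    end≡E : o + sizeCh ((w , t , c) ∷ []) ≡ o + 2 * suc w + size t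
    end≡E = trans (+-sizeCh-∷ o w t c [])
              (trans (+-identityʳ _) (trans (cong (o + 2 * suc w + size t +_) e) (+-identityʳ _)))
  lastCorner≡0⇒endpoint o pc (w , t , c) (y ∷ ys) e with lastCorner≡0⇒endpoint (o + 2 * suc w + size t + c) c y ys e
  ... | k , m = k , subst (λ v → (k , v) ∈ linksCh o ((w , t , c) ∷ y ∷ ys)) (sym (+-sizeCh-∷ o w t c (y ∷ ys)))
                      (∈-linksCh-rest {o} {w} {t} {c} {y ∷ ys} m)

  -- (i , j) sits just inside the innermost link (q , q + size t + 1) above t.
  ¬inward-innermost : ∀ q t → links q t ⊆ S → i ≡ suc q → j ≡ q + size t →
    AllNodes (LeafBounded θ) false t → AllNodes AdjacentNotBothPositive false t → ⊥
  ¬inward-innermost q (node c []) sub ei ej (leaf , _) _ with leaf refl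
  ... | c≤ ∷ [] = <-irrefl refl (<-≤-trans θ< j∸i≤θ)
    where
    j∸i≡c∸1 : j ∸ i ≡ c + 0 ∸ 1
    j∸i≡c∸1 = trans (cong₂ _∸_ ej (trans ei (+-comm 1 q))) ([m+n]∸[m+o]≡n∸o q (c + 0) 1)
    j∸i≤θ : j ∸ i ≤ θ
    j∸i≤θ = subst (_≤ θ) (sym j∸i≡c∸1) (∸-monoˡ-≤ 1 (≤-trans (≤-reflexive (+-identityʳ c)) c≤))
  ¬inward-innermost q (node c ((w , t , d) ∷ cs)) sub ei ej _ (adjacent , _)
    with ++⁻ʳ (consecutive c ((w , t , d) ∷ cs)) adjacent
  ... | wrap ∷ [] = wrap (n≢0⇒n>0 last≢0 , n≢0⇒n>0 c≢0)
    where
    c≢0 : c ≢ 0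
    c≢0 e = ¬endpoint fi (endpointˡ (subst (λ v → (v , q + c + 2 * suc w + size t) ∈ S)
              (trans (cong (λ v → suc (q + v)) e) (trans (cong suc (+-identityʳ q)) (sym ei)))
              (sub (∈-linksCh-stem {q + c} {w} {t} {d} {cs} stemLinks-outermost))))
    last≢0 : lastCorner c ((w , t , d) ∷ cs) ≢ 0
    last≢0 e with lastCorner≡0⇒endpoint (q + c) c (w , t , d) cs e
    ... | k , m = ¬endpoint fj (endpointʳ (subst (λ v → (k , v) ∈ S)
                    (sym (trans ej (sym (+-assoc q c (sizeCh ((w , t , d) ∷ cs)))))) (sub m)))

  -- Stacking (i , j) inside a stem link hits the next link, unless that link is the innermost one.
  ¬inward-on-stem : ∀ o w t c cs {a b} → linksCh o ((w , t , c) ∷ cs) ⊆ S → Stacked (a , b) (i , j) →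
    AllNodes (LeafBounded θ) false t → AllNodes AdjacentNotBothPositive false t →
    (a , b) ∈ stemLinks o w (size t) → ⊥
  ¬inward-on-stem o w t c cs sub (ei , ej) leaves adjacent ab∈ with ∈-stemLinks⁻ ab∈
  ... | m , m≤w , ea , eb with m≤n⇒m<n∨m≡n m≤w
  ...   | inj₁ m<w = ¬endpoint fi (endpointˡ {l = suc (o + suc w + size t + (w ∸ suc m))}
                       (subst (λ v → (v , _) ∈ S) (sym i≡) (sub (∈-linksCh-stem {o} {w} {t} {c} {cs} (∈-stemLinks⁺ m<w)))))
    where
    i≡ : i ≡ o + suc (suc m)
    i≡ = trans ei (trans (cong suc ea) (sym (+-suc o (suc m))))
  ...   | inj₂ refl = ¬inward-innermost (o + suc m) t (λ x → sub (∈-linksCh-child {o} {m} {t} {c} {cs} x))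
                        (trans ei (cong suc ea))
                        (suc-injective (trans ej (trans eb (cong suc (trans (cong (o + suc m + size t +_) (n∸n≡0 m))
                                                                            (+-identityʳ _))))))
                        leaves adjacent

  -- Stacking (i , j) around a stem link hits the previous link, unless that link is the outermost
  -- one; then i and j lie in the two corners flanking the stem, which must both be non-empty.
  ¬outward-on-stem : ∀ o pc w t c cs {a b} → BlockedBefore o pc → BlockedAfter o pc ((w , t , c) ∷ cs) →
    linksCh o ((w , t , c) ∷ cs) ⊆ S → NotBothPositive (pc , c) → Stacked (i , j) (a , b) →
    (a , b) ∈ stemLinks o w (size t) → ⊥
  ¬outward-on-stem o pc w t c cs before after sub flanking (ea' , eb') ab∈ with ∈-stemLinks⁻ ab∈
  ... | suc m , m≤w , ea , _ =
    ¬endpoint fi (endpointˡ {l = suc (o + suc w + size t + (w ∸ m))}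
      (subst (λ v → (v , _) ∈ S) (sym i≡) (sub (∈-linksCh-stem {o} {w} {t} {c} {cs} (∈-stemLinks⁺ (≤-trans (n≤1+n m) m≤w))))))
    where
    i≡ : i ≡ o + suc m
    i≡ = suc-injective (trans (sym ea') (trans ea (+-suc o (suc m))))
  ... | zero , _ , ea , eb = flanking (n≢0⇒n>0 pc≢0 , n≢0⇒n>0 c≢0)
    where
    E : ℕ
    E = o + 2 * suc w + size t
    i≡o : i ≡ o
    i≡o = suc-injective (trans (sym ea') (trans ea (+-comm o 1)))
    j≡1+E : j ≡ suc E
    j≡1+E = trans (sym eb') (cong suc (trans eb (stem-span o w (size t))))
    pc≢0 : pc ≢ 0
    pc≢0 pc≡0 = [ (λ ep → ¬endpoint fi (subst Endpoint (sym i≡o) ep))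
                , (λ o≡0 → <-irrefl refl (≤-trans 1≤i (≤-reflexive (trans i≡o o≡0)))) ]′ (before pc≡0)
    c≢0 : c ≢ 0
    c≢0 c≡0 = blocked cs after sub
      where
      E+c≡E : E + c ≡ E
      E+c≡E = trans (cong (E +_) c≡0) (+-identityʳ E)
      blocked : ∀ cs → BlockedAfter o pc ((w , t , c) ∷ cs) → linksCh o ((w , t , c) ∷ cs) ⊆ S → ⊥
      blocked [] after′ _ =
        [ (λ ep → ¬endpoint fj (subst Endpoint (sym j≡end) ep))
        , (λ n<end → <-irrefl refl (<-≤-trans n<end (subst (_≤ n) j≡end j≤n))) ]′ (after′ c≡0)
        where
        j≡end : j ≡ suc (o + sizeCh ((w , t , c) ∷ []))
        j≡end = trans j≡1+E (cong suc (sym (trans (+-sizeCh-∷ o w t c []) (trans (+-identityʳ _) E+c≡E))))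
      blocked ((w₂ , t₂ , c₂) ∷ cs₂) _ sub′ =
        ¬endpoint fj (endpointˡ (subst (λ v → (v , E + c + 2 * suc w₂ + size t₂) ∈ S) (trans (cong suc E+c≡E) (sym j≡1+E))
          (sub′ (∈-linksCh-rest {o} {w} {t} {c} {(w₂ , t₂ , c₂) ∷ cs₂}
                   (∈-linksCh-stem {E + c} {w₂} {t₂} {c₂} {cs₂} stemLinks-outermost)))))

  module _ {a b : ℕ} (stacked : Stacked (a , b) (i , j) ⊎ Stacked (i , j) (a , b)) where
    mutual
      ¬in-node : ∀ q t → Endpoint q → Endpoint (suc (q + size t)) → links q t ⊆ S →
        AllNodes (LeafBounded θ) false t → AllNodes AdjacentNotBothPositive false t → (a , b) ∉ links q t
      ¬in-node q (node c cs) ep-q ep-end sub (_ , leaves) (adjacent , adjacents) =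
        ¬in-children (q + c) c cs before after sub (++⁻ˡ (consecutive c cs) adjacent) leaves adjacents
        where
        before : BlockedBefore (q + c) c
        before c≡0 = inj₁ (subst Endpoint (trans (sym (+-identityʳ q)) (cong (q +_) (sym c≡0))) ep-q)
        after : BlockedAfter (q + c) c cs
        after _ = inj₁ (subst (λ v → Endpoint (suc v)) (sym (+-assoc q c _)) ep-end)

      ¬in-children : ∀ o pc cs → BlockedBefore o pc → BlockedAfter o pc cs → linksCh o cs ⊆ S →
        All NotBothPositive (consecutive pc cs) → AllNodesCh (LeafBounded θ) cs →
        AllNodesCh AdjacentNotBothPositive cs → (a , b) ∉ linksCh o cs
      ¬in-children o pc ((w , t , c) ∷ cs) before after sub (flanking ∷ edges) (leaves-t , leaves)
                   (adjacent-t , adjacent) ab∈ with ∈-linksCh-∷⁻ {o} {w} {t} {c} {cs} ab∈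
      ... | inj₁ y = [ (λ st → ¬inward-on-stem o w t c cs sub st leaves-t adjacent-t y)
                     , (λ st → ¬outward-on-stem o pc w t c cs before after sub flanking st y) ]′ stacked
      ¬in-children o pc ((w , t , c) ∷ cs) before after sub _ (leaves-t , _) (adjacent-t , _) ab∈
        | inj₂ (inj₁ y) =
        ¬in-node (o + suc w) t (endpointˡ innermost) (endpointʳ innermost)
          (λ x → sub (∈-linksCh-child {o} {w} {t} {c} {cs} x)) leaves-t adjacent-t y
        where
        innermost : (o + suc w , suc (o + suc w + size t)) ∈ S
        innermost = sub (∈-linksCh-stem {o} {w} {t} {c} {cs} stemLinks-innermost)
      ¬in-children o pc ((w , t , c) ∷ cs) before after sub (_ ∷ edges) (_ , leaves) (_ , adjacent) ab∈
        | inj₂ (inj₂ y) =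
        ¬in-children (E + c) c cs before′ after′ (λ x → sub (∈-linksCh-rest {o} {w} {t} {c} {cs} x))
          edges leaves adjacent y
        where
        E : ℕ
        E = o + 2 * suc w + size t
        before′ : BlockedBefore (E + c) c
        before′ c≡0 = inj₁ (subst Endpoint (sym (trans (cong (E +_) c≡0) (+-identityʳ E)))
                        (endpointʳ (sub (∈-linksCh-stem {o} {w} {t} {c} {cs} stemLinks-outermost))))
        after′ : BlockedAfter (E + c) c cs
        after′ e = subst (λ v → Endpoint (suc v) ⊎ n < suc v) (+-sizeCh-∷ o w t c cs) (after e)
added-link-free : ∀ {θ τ n S i j} → SecStruct θ τ n ((i , j) ∷ S) → (i , j) ∉ S → Free S i × Free S j
added-link-free {S = S} {i} {j} SS' notin =
    (λ k l m → proj₁ (apart k l m) , proj₁ (proj₂ (apart k l m)))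
  , (λ k l m → proj₁ (proj₂ (proj₂ (apart k l m))) , proj₂ (proj₂ (proj₂ (apart k l m))))
  where
  apart : ∀ k l → (k , l) ∈ S → (i ≢ k) × (i ≢ l) × (j ≢ k) × (j ≢ l)
  apart k l m = SecStruct.disjoint SS' i j k l (here refl) (there m) (λ eq → notin (subst (_∈ S) (sym eq) m))

root-wrap : ∀ c cs → All NotBothPositive (consecutive c cs) → All NotBothPositive (wrapPair true c cs)
root-wrap c [] _ = []
root-wrap c (_ ∷ []) (flanking ∷ []) = (λ (p , q) → flanking (q , p)) ∷ []
root-wrap c (_ ∷ _ ∷ _) _ = []

nonempty-⊈[] : ∀ {S : List Link} → 1 ≤ length S → ¬ (S ⊆ [])
nonempty-⊈[] {_ ∷ _} _ sub with sub (here refl)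
... | ()

saturated⇒conditions : ∀ {θ τ n S} c cs → SecStruct θ τ n S → S ⊆ linksCh c cs → linksCh c cs ⊆ S →
  c + sizeCh cs ≤ n → cs ≢ [] → GSaturated θ τ n S → CondLeaf θ (node c cs) × CondAdj (node c cs)
saturated⇒conditions c cs SS S⊆ ⊆S bnd cs≢[] G
  with Forward.saturated-children SS G c c cs ⊆S (λ k l m → (λ _ → S⊆ m) , (λ _ → S⊆ m)) bnd ≤-refl
         (λ _ k l m → range-below (linksCh-range c cs k l (S⊆ m)) ≤-refl)
... | edges , leaves , adjacent =
  ((λ cs≡[] → ⊥-elim (cs≢[] cs≡[])) , leaves) , (++⁺ edges (root-wrap c cs edges) , adjacent)

conditions⇒saturated : ∀ {θ τ n S} c cs → S ⊆ linksCh c cs → linksCh c cs ⊆ S → c + sizeCh cs ≡ n →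
  CondLeaf θ (node c cs) × CondAdj (node c cs) → GSaturated θ τ n S
conditions⇒saturated {θ} {τ} {n} {S} c cs S⊆ ⊆S size≡n ((_ , leaves) , (adjacent , adjacents)) i j notin SS' =
  [ (λ (a , b , ab∈ , st) → refute ab∈ (inj₁ st)) , (λ (a , b , ab∈ , st) → refute ab∈ (inj₂ st)) ]′
  where
  open SecStruct SS'
  free : Free S i × Free S j
  free = added-link-free SS' notin
  range : (1 ≤ i) × (i < j) × (j ≤ n)
  range = inRange i j (here refl)
  refute : ∀ {a b} → (a , b) ∈ S → Stacked (a , b) (i , j) ⊎ Stacked (i , j) (a , b) → ⊥
  refute ab∈ stacked =
    Backward.¬in-children i j (proj₁ free) (proj₂ free) (proj₁ range) (proj₂ (proj₂ range))
      (minLoop i j (here refl)) stacked c c cs inj₂ (λ _ → inj₂ (s≤s (≤-reflexive (sym size≡n)))) ⊆S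
      (++⁻ˡ (consecutive c cs) adjacent) leaves adjacents (S⊆ ab∈)

lemma2 : (θ τ n : ℕ) (S : List Link) → SecStruct θ τ n S → 1 ≤ length S →
    (T : WTree) → IsDual θ τ n S T →
    GSaturated θ τ n S ⇔ (CondLeaf θ T × CondAdj T)
lemma2 θ τ n S SS 1≤|S| (node c cs) (_ , size≡n , S⇔links) =
  mk⇔ (saturated⇒conditions c cs SS S⊆ ⊆S (≤-reflexive size≡n) cs≢[])
      (conditions⇒saturated c cs S⊆ ⊆S size≡n)
  where
  S⊆ : S ⊆ linksCh c cs
  S⊆ = proj₁ (S⇔links _)
  ⊆S : linksCh c cs ⊆ S
  ⊆S = proj₂ (S⇔links _)
  cs≢[] : cs ≢ []
  cs≢[] cs≡[] = nonempty-⊈[] 1≤|S| (subst (λ cs → S ⊆ linksCh c cs) cs≡[] S⊆)
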